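{- Let $U,V$ be $\lambda H$-terms. If $U\rightarrow_{J^*}V$, then $E(U)=E(V)$.
   Context: $\lambda H$-terms are the $\lambda$-terms built from variables and one additional constant $H$ by abstraction and application. Application is left-associative. The $J$-reduction is the head reduction step $\lambda\overline{x}\,H\,U_1U_2U_3\ldots U_n\rightarrow_J\lambda\overline{x}\,U_1\,(H\,U_2)\,U_3\ldots U_n$ for $n\ge2$, and $\lambda\overline{x}\,H\,U_1\rightarrow_J\lambda\overline{x}\,U_1$ ($\lambda\overline{x}$ a possibly empty sequence of abstractions); $\rightarrow_{J^*}$ is its reflexive transitive closure. The map $E$ on $\lambda H$-terms is defined by induction: $E(x)=x$ for variables $x$; $E(H)=H$; $E(\lambda x\,U)=\lambda x\,E(U)$; $E(U\,V)=E(U)\,E(V)$ if $U$ is not of the form $H\,U_1\ldots U_n$ with $n\ge 0$; and $E(H\,U_1U_2\ldots U_n)=E(U_1U_2\ldots U_n)$ for $n\ge1$. -}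

module Defs where

open import Data.Nat using (ℕ; zero; suc; _+_)
open import Data.List using (List; []; _∷_; _∷ʳ_; foldl)
open import Data.Maybe using (Maybe; just; nothing)
import Data.Maybe as Maybe
open import Relation.Binary.Construct.Closure.ReflexiveTransitive using (Star)

data Term : Set where
  var : ℕ → Term
  H   : Term
  lam : ℕ → Term → Term
  app : Term → Term → Term

apps : Term → List Term → Term
apps U Us = foldl app U Us

hspine : Term → Maybe (List Term)
hspine H         = just []
hspine (app U V) = Maybe.map (_∷ʳ V) (hspine U)
hspine (var x)   = nothing
hspine (lam x U) = nothing

size : Term → ℕ
size (var x)   = 1
size H         = 1
size (lam x U) = suc (size U)
size (app U V) = suc (size U + size V)

-- The map E, defined by the clauses of the paper; the recursion on
-- E(H U₁ … Uₙ) = E(U₁ … Uₙ) is not structural, so it is run with fuel,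
-- and E uses fuel = size U, which is always sufficient (each recursive
-- call is on a strictly smaller term).
E-fuel : ℕ → Term → Term
E-fuel zero      U         = U
E-fuel (suc k)   (var x)   = var x
E-fuel (suc k)   H         = H
E-fuel (suc k)   (lam x U) = lam x (E-fuel k U)
E-fuel (suc k)   (app U V) with hspine U
... | nothing        = app (E-fuel k U) (E-fuel k V)
... | just []        = E-fuel k V
... | just (U₁ ∷ Us) = E-fuel k (apps U₁ (Us ∷ʳ V))

E : Term → Term
E U = E-fuel (size U) U

data _→J_ : Term → Term → Set where
  J-lam : ∀ {x U V} → U →J V → lam x U →J lam x V
  J-one : ∀ {U₁} → app H U₁ →J U₁
  J-many : ∀ {U₁ U₂} (Us : List Term) →
           apps (app (app H U₁) U₂) Us →J apps (app U₁ (app H U₂)) Us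

_→J*_ : Term → Term → Set
_→J*_ = Star _→J_

-- E agrees with the structurally recursive map E′ that interprets application
-- by an application absorbing a head H (H · y = y).  Under E′ the two sides of
-- a J-step have the same image on the nose, and the image of an application
-- spine T U₁ … Uₙ depends only on the image of its head T.
module Submission where

open import Defs
open import Data.Nat using (suc; _≤_; _<_; s≤s)
open import Data.Nat.Properties using (≤-refl; ≤-trans; m≤m+n; m≤n+m; +-monoˡ-<)
open import Data.List using (List; []; _∷_; _∷ʳ_)
open import Data.List.Properties using (foldl-∷ʳ)
open import Data.Maybe using (just; nothing)
open import Relation.Binary.Construct.Closure.ReflexiveTransitive using (fold)
open import Relation.Binary.PropositionalEquality
  using (_≡_; _≗_; refl; sym; trans; cong; cong₂; subst; module ≡-Reasoning)

happ : Term → Term → Term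
happ H y = y
happ x y = app x y

E′ : Term → Term
E′ (var x)   = var x
E′ H         = H
E′ (lam x U) = lam x (E′ U)
E′ (app U V) = happ (E′ U) (E′ V)

apps-∷ʳ : ∀ T Us V → apps T (Us ∷ʳ V) ≡ app (apps T Us) V
apps-∷ʳ T Us V = foldl-∷ʳ app T V Us

hspine-sound : ∀ U {Us} → hspine U ≡ just Us → U ≡ apps H Us
hspine-sound H           refl = refl
hspine-sound (app U₁ U₂) eq   with hspine U₁ in eq₁
hspine-sound (app U₁ U₂) refl | just Vs =
  trans (cong (λ T → app T U₂) (hspine-sound U₁ eq₁)) (sym (apps-∷ʳ H Vs U₂))

size-apps-monoˡ-< : ∀ {T T′} Us → size T < size T′ → size (apps T Us) < size (apps T′ Us)
size-apps-monoˡ-< []       lt = lt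
size-apps-monoˡ-< (U ∷ Us) lt = size-apps-monoˡ-< Us (s≤s (+-monoˡ-< (size U) lt))

size-hspine-tail : ∀ U {c cs} → hspine U ≡ just (c ∷ cs) → size (apps c cs) < size U
size-hspine-tail U {c} {cs} eq =
  subst (λ T → size (apps c cs) < size T) (sym (hspine-sound U eq))
        (size-apps-monoˡ-< cs (s≤s (m≤n+m (size c) 1)))

E′-apps-cong : ∀ {T T′} Us → E′ T ≡ E′ T′ → E′ (apps T Us) ≡ E′ (apps T′ Us)
E′-apps-cong []       eq = eq
E′-apps-cong (U ∷ Us) eq = E′-apps-cong Us (cong (λ t → happ t (E′ U)) eq)

E′-hspine : ∀ U {c cs} → hspine U ≡ just (c ∷ cs) → E′ U ≡ E′ (apps c cs)
E′-hspine U {c} {cs} eq = trans (cong E′ (hspine-sound U eq)) (E′-apps-cong cs refl)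

happ-E′-headless : ∀ U → hspine U ≡ nothing → ∀ y → happ (E′ U) y ≡ app (E′ U) y
happ-E′-headless (var x)     eq y = refl
happ-E′-headless (lam x U)   eq y = refl
happ-E′-headless (app U₁ U₂) eq y with hspine U₁ in eq₁
... | nothing = subst (λ t → happ t y ≡ app t y) (sym (happ-E′-headless U₁ eq₁ (E′ U₂))) refl

E-fuel≡E′ : ∀ k U → size U ≤ k → E-fuel k U ≡ E′ U
E-fuel≡E′ (suc k) (var x)   _       = refl
E-fuel≡E′ (suc k) H         _       = refl
E-fuel≡E′ (suc k) (lam x U) (s≤s p) = cong (lam x) (E-fuel≡E′ k U p)
E-fuel≡E′ (suc k) (app U V) (s≤s p) with hspine U in eq
... | nothing = trans (cong₂ app (E-fuel≡E′ k U (≤-trans (m≤m+n _ _) p))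
                                 (E-fuel≡E′ k V (≤-trans (m≤n+m _ _) p)))
                      (sym (happ-E′-headless U eq (E′ V)))
... | just [] = trans (E-fuel≡E′ k V (≤-trans (m≤n+m _ _) p))
                      (cong (λ T → happ (E′ T) (E′ V)) (sym (hspine-sound U eq)))
... | just (c ∷ cs) = begin
  E-fuel k (apps c (cs ∷ʳ V))   ≡⟨ E-fuel≡E′ k _ bound ⟩
  E′ (apps c (cs ∷ʳ V))         ≡⟨ cong E′ (apps-∷ʳ c cs V) ⟩
  happ (E′ (apps c cs)) (E′ V)  ≡⟨ cong (λ t → happ t (E′ V)) (sym (E′-hspine U eq)) ⟩
  happ (E′ U) (E′ V)            ∎
  where
  open ≡-Reasoning
  bound : size (apps c (cs ∷ʳ V)) ≤ k
  bound rewrite apps-∷ʳ c cs V = ≤-trans (+-monoˡ-< (size V) (size-hspine-tail U eq)) p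

E≗E′ : E ≗ E′
E≗E′ U = E-fuel≡E′ (size U) U ≤-refl

-- Both sides of J-many are sent to happ (E′ U₁) (E′ U₂) by computation.
→J-preserves-E′ : ∀ {U V} → U →J V → E′ U ≡ E′ V
→J-preserves-E′ (J-lam r)   = cong (lam _) (→J-preserves-E′ r)
→J-preserves-E′ J-one       = refl
→J-preserves-E′ (J-many Us) = E′-apps-cong Us refl

→J*-preserves-E′ : ∀ {U V} → U →J* V → E′ U ≡ E′ V
→J*-preserves-E′ = fold (λ U V → E′ U ≡ E′ V) (λ r → trans (→J-preserves-E′ r)) refl

lemma3p10 : (U V : Term) → U →J* V → E U ≡ E V
lemma3p10 U V r = begin
  E U   ≡⟨ E≗E′ U ⟩
  E′ U  ≡⟨ →J*-preserves-E′ r ⟩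
  E′ V  ≡⟨ E≗E′ V ⟨
  E V   ∎
  where open ≡-Reasoning
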